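{- Let $G$ be a finite reflexive graph and $L$ a distributive lattice on $V(G)$ compatible with $G$. Then there exist integers $d\ge1$, $n_1,\dots,n_d\ge0$, a set $\mathcal{V}$ which is a union of vertex intervals of $\mathcal{P}=\prod_{i=1}^d\{0,1,\dots,n_i\}$ (product of chains with the componentwise order), a lattice isomorphism $\varphi$ from $L$ onto $\mathcal{P}\setminus\mathcal{V}$ (a sublattice of $\mathcal{P}$), and for each $i$ a reflexive proper interval graph $G_i$ on $\{0,\dots,n_i\}$ compatible with the chain $0<1<\dots<n_i$, such that $\varphi$ is a graph isomorphism from $G$ onto the subgraph of the categorical product $\prod_{i=1}^d G_i$ induced by $\mathcal{P}\setminus\mathcal{V}$.
   Context: A lattice $L$ on $V(G)$ is compatible with the reflexive graph $G$ if whenever $u\sim u'$ and $v\sim v'$ we have $u\wedge v\sim u'\wedge v'$ and $u\vee v\sim u'\vee v'$. A reflexive graph on $\{0,\dots,n\}$ is a proper interval graph (in min-max form) if $u'\le u\le v\le v'$ and $u'\sim v'$ imply $u\sim v$. The categorical product $\prod G_i$ has vertex set $\prod V(G_i)$ with $x\sim y$ iff $x_i\sim y_i$ in $G_i$ for all $i$. A vertex interval of $\mathcal{P}=\prod_{i=1}^d\{0,\dots,n_i\}$ is a set $\{x\in\mathcal{P}:\alpha\le x_i\text{ and }x_j\le\beta\}$ for some $i,j\in\{1,\dots,d\}$, $0\le\alpha\le n_i$, $0\le\beta\le n_j$. -}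

module Defs where

open import Data.Nat using (ℕ; suc; _≤_; _⊓_; _⊔_)
open import Data.Fin using (Fin; toℕ)
open import Data.Bool using (Bool; true)
open import Data.List using (List)
open import Data.List.Relation.Unary.Any using (Any)
open import Data.Product using (Σ; _×_; ∃)
open import Relation.Binary.PropositionalEquality using (_≡_)
open import Relation.Nullary using (¬_)
open import Algebra.Core using (Op₂)
open import Algebra.Lattice.Structures using (IsDistributiveLattice)

record ReflGraph (m : ℕ) : Set where
  field
    adj   : Fin m → Fin m → Bool
    refl′ : ∀ u → adj u u ≡ true
    sym′  : ∀ u v → adj u v ≡ adj v u

_∼⟨_⟩_ : ∀ {m} → Fin m → ReflGraph m → Fin m → Set
u ∼⟨ G ⟩ v = ReflGraph.adj G u v ≡ true

Compatible : ∀ {m} → ReflGraph m → Op₂ (Fin m) → Op₂ (Fin m) → Set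
Compatible G _∨_ _∧_ =
  ∀ u u′ v v′ → u ∼⟨ G ⟩ u′ → v ∼⟨ G ⟩ v′ →
    ((u ∧ v) ∼⟨ G ⟩ (u′ ∧ v′)) × ((u ∨ v) ∼⟨ G ⟩ (u′ ∨ v′))

minF : ∀ {k} → Fin k → Fin k → Fin k
minF {k} a b with toℕ a Data.Nat.≤? toℕ b
... | Relation.Nullary.yes _ = a
... | Relation.Nullary.no  _ = b

maxF : ∀ {k} → Fin k → Fin k → Fin k
maxF {k} a b with toℕ a Data.Nat.≤? toℕ b
... | Relation.Nullary.yes _ = b
... | Relation.Nullary.no  _ = a

-- proper interval graph in min-max form
ProperInterval : ∀ {k} → ReflGraph k → Set
ProperInterval G = ∀ u′ u v v′ → toℕ u′ ≤ toℕ u → toℕ u ≤ toℕ v → toℕ v ≤ toℕ v′ →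
  u′ ∼⟨ G ⟩ v′ → u ∼⟨ G ⟩ v

Point : (d : ℕ) → (Fin d → ℕ) → Set
Point d n = (i : Fin d) → Fin (suc (n i))

_≈P_ : ∀ {d n} → Point d n → Point d n → Set
x ≈P y = ∀ i → x i ≡ y i

_⊓P_ : ∀ {d n} → Point d n → Point d n → Point d n
(x ⊓P y) i = minF (x i) (y i)

_⊔P_ : ∀ {d n} → Point d n → Point d n → Point d n
(x ⊔P y) i = maxF (x i) (y i)

record VInterval (d : ℕ) (n : Fin d → ℕ) : Set where
  constructor vint
  field
    i : Fin d
    j : Fin d
    α : Fin (suc (n i))
    β : Fin (suc (n j))

InVI : ∀ {d n} → VInterval d n → Point d n → Set
InVI I x = toℕ (VInterval.α I) ≤ toℕ (x (VInterval.i I)) ×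
           toℕ (x (VInterval.j I)) ≤ toℕ (VInterval.β I)

InUnion : ∀ {d n} → List (VInterval d n) → Point d n → Set
InUnion Vs x = Any (λ I → InVI I x) Vs

module Submission where

-- Call a pair (p , q) of join-primes admissible when q lies below the least neighbour of p.
-- Then x ↦ (2 if p ≤ x, 1 if only q ≤ x, 0 otherwise) is a lattice homomorphism onto the
-- chain 0 < 1 < 2, since p and q are join-prime, and a graph homomorphism onto the path
-- 0 — 1 — 2, since p ≤ x ~ y forces q ≤ y. These coordinates separate distinct elements
-- (below u but not below v there is a join-prime) and non-adjacent ones (descending twice
-- from u ∨ v gives p ≤ u, q ≰ v up to symmetry, i.e. coordinates 2 and 0). Finally, the
-- image of any lattice homomorphism into a product of chains is the complement of the
-- vertex intervals it misses: if x meets none of them, every interval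
-- {y : x i ≤ y i, y j ≤ x j} contains some φ (u i j), and φ (⋁ᵢ ⋀ⱼ u i j) = x.

open import Defs
open import Data.Nat using (ℕ; suc; _≥_; s≤s; z≤n; _*_; _⊓_; _⊔_)
import Data.Nat as ℕ
import Data.Nat.Properties as ℕ
open import Data.Fin using (Fin; suc; toℕ; _≟_; combine; remQuot)
open import Data.Fin.Patterns using (0F; 1F; 2F)
open import Data.Fin.Properties using (all?; any?; toℕ-injective; remQuot-combine)
open import Data.Fin.Induction using (po-wellFounded)
open import Data.Bool as Bool using (Bool; true; false; f≤t; b≤b) renaming (_≤_ to _≤ᵇ_)
open import Data.List using (List; []; _∷_; foldr; filter; concatMap; map; allFin)
open import Data.List.Membership.Propositional using (_∈_; lose; find)
open import Data.List.Membership.Propositional.Properties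
  using (∈-allFin; ∈-concatMap⁺; ∈-map⁺; ∈-filter⁺; ∈-filter⁻)
open import Data.List.Relation.Unary.All using (All; []; _∷_)
open import Data.List.Relation.Unary.All.Properties using (all-filter)
open import Data.List.Relation.Unary.Any using (here; there)
open import Data.Product using (Σ; ∃; ∃₂; _×_; _,_; proj₁; proj₂)
open import Data.Sum as Sum using (_⊎_; inj₁; inj₂)
open import Data.Unit using (⊤; tt)
open import Function using (_∘_)
open import Function.Bundles using (_⇔_; mk⇔)
open import Induction.WellFounded using (Acc; acc)
open import Relation.Nullary using (¬_; Dec; yes; no; does; contradiction)
open import Relation.Nullary.Decidable using (_×-dec_; _⊎-dec_; _→-dec_; ¬?; does-⇔; dec-true; dec-false; decidable-stable; toWitness)
open import Relation.Binary.PropositionalEquality using (_≡_; _≢_; refl; sym; trans; cong; cong₂; subst; subst₂; module ≡-Reasoning)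
open import Relation.Binary.Construct.NonStrictToStrict using () renaming (_<_ to Strict)
open import Algebra.Core using (Op₂)
open import Algebra.Lattice.Bundles using (Lattice)
open import Algebra.Lattice.Structures using (IsDistributiveLattice)
import Algebra.Lattice.Properties.Lattice as AlgebraicLatticeProperties
import Relation.Binary.Lattice as OrderTheoretic
import Relation.Binary.Lattice.Properties.JoinSemilattice as JoinSemilatticeProperties

path₃-adj : Fin 3 → Fin 3 → Bool
path₃-adj 0F 2F = false
path₃-adj 2F 0F = false
path₃-adj _  _  = true

path₃ : ReflGraph 3
path₃ = record
  { adj   = path₃-adj
  ; refl′ = toWitness {a? = all? λ u → path₃-adj u u Bool.≟ true} _
  ; sym′  = toWitness {a? = all? λ u → all? λ v → path₃-adj u v Bool.≟ path₃-adj v u} _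
  }

path₃-properInterval : ProperInterval path₃
path₃-properInterval = toWitness {a? = all? λ u′ → all? λ u → all? λ v → all? λ v′ →
  (toℕ u′ ℕ.≤? toℕ u) →-dec (toℕ u ℕ.≤? toℕ v) →-dec (toℕ v ℕ.≤? toℕ v′) →-dec
  (path₃-adj u′ v′ Bool.≟ true) →-dec (path₃-adj u v Bool.≟ true)} _

path₃-compatible : Compatible path₃ maxF minF
path₃-compatible = toWitness {a? = all? λ u → all? λ u′ → all? λ v → all? λ v′ →
  (path₃-adj u u′ Bool.≟ true) →-dec (path₃-adj v v′ Bool.≟ true) →-dec
  ((path₃-adj (minF u v) (minF u′ v′) Bool.≟ true) ×-dec
   (path₃-adj (maxF u v) (maxF u′ v′) Bool.≟ true))} _

level : Bool → Bool → Fin 3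
level _     true  = 2F
level true  false = 1F
level false false = 0F

level-∧ : ∀ {a b c d} → b ≤ᵇ a → d ≤ᵇ c →
  level (a Bool.∧ c) (b Bool.∧ d) ≡ minF (level a b) (level c d)
level-∧ (b≤b {false}) (b≤b {false}) = refl
level-∧ (b≤b {false}) f≤t           = refl
level-∧ (b≤b {false}) (b≤b {true})  = refl
level-∧ f≤t           (b≤b {false}) = refl
level-∧ f≤t           f≤t           = refl
level-∧ f≤t           (b≤b {true})  = refl
level-∧ (b≤b {true})  (b≤b {false}) = refl
level-∧ (b≤b {true})  f≤t           = refl
level-∧ (b≤b {true})  (b≤b {true})  = refl

level-∨ : ∀ a b c d → level (a Bool.∨ c) (b Bool.∨ d) ≡ maxF (level a b) (level c d)
level-∨ _     true  _     true  = refl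
level-∨ _     true  false false = refl
level-∨ _     true  true  false = refl
level-∨ false false _     true  = refl
level-∨ true  false _     true  = refl
level-∨ false false false false = refl
level-∨ false false true  false = refl
level-∨ true  false false false = refl
level-∨ true  false true  false = refl

level-adjacent : ∀ {a b c d} → b ≤ᵇ c → d ≤ᵇ a → level a b ∼⟨ path₃ ⟩ level c d
level-adjacent {_}     {true}  {_}     {true}  _ _ = refl
level-adjacent {_}     {true}  {true}  {false} _ _ = refl
level-adjacent {true}  {false} {_}     {true}  _ _ = refl
level-adjacent {false} {false} {false} {false} _ _ = refl
level-adjacent {false} {false} {true}  {false} _ _ = refl
level-adjacent {true}  {false} {false} {false} _ _ = refl
level-adjacent {true}  {false} {true}  {false} _ _ = refl

level-false≢2 : ∀ a → level a false ≢ 2F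
level-false≢2 true  ()
level-false≢2 false ()

does-mono : ∀ {A B : Set} → (A → B) → (a? : Dec A) (b? : Dec B) → does a? ≤ᵇ does b?
does-mono _   (yes _) (yes _) = b≤b
does-mono _   (no _)  (yes _) = f≤t
does-mono _   (no _)  (no _)  = b≤b
does-mono A→B (yes a) (no ¬b) = contradiction (A→B a) ¬b

toℕ-minF : ∀ {k} (a b : Fin k) → toℕ (minF a b) ≡ toℕ a ⊓ toℕ b
toℕ-minF a b with toℕ a ℕ.≤? toℕ b
... | yes a≤b = sym (ℕ.m≤n⇒m⊓n≡m a≤b)
... | no  a≰b = sym (ℕ.m≥n⇒m⊓n≡n (ℕ.≰⇒≥ a≰b))

toℕ-maxF : ∀ {k} (a b : Fin k) → toℕ (maxF a b) ≡ toℕ a ⊔ toℕ b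
toℕ-maxF a b with toℕ a ℕ.≤? toℕ b
... | yes a≤b = sym (ℕ.m≤n⇒m⊔n≡n a≤b)
... | no  a≰b = sym (ℕ.m≥n⇒m⊔n≡m (ℕ.≰⇒≥ a≰b))

module FiniteDistributiveLattice {m : ℕ} {_∨_ _∧_ : Op₂ (Fin m)}
  (isDistributiveLattice : IsDistributiveLattice _≡_ _∨_ _∧_) where

  open IsDistributiveLattice isDistributiveLattice public
    using (∨-comm; ∧-comm; ∨-absorbs-∧; ∧-distribˡ-∨)
  open IsDistributiveLattice isDistributiveLattice using (isLattice)

  lattice : Lattice _ _
  lattice = record { isLattice = isLattice }

  open AlgebraicLatticeProperties lattice public using (∧-idem)

  orderTheoreticLattice : OrderTheoretic.Lattice _ _ _
  orderTheoreticLattice = AlgebraicLatticeProperties.∨-∧-orderTheoreticLattice lattice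

  open OrderTheoretic.Lattice orderTheoreticLattice public
    using (_≤_; isPartialOrder; x≤x∨y; y≤x∨y; ∨-least; x∧y≤x; x∧y≤y; ∧-greatest)
    renaming (refl to ≤-refl; trans to ≤-trans; antisym to ≤-antisym)
  open JoinSemilatticeProperties (OrderTheoretic.Lattice.joinSemilattice orderTheoreticLattice)
    public using (x≤y⇒x∨y≈y)

  _≤?_ : ∀ x y → Dec (x ≤ y)
  x ≤? y = x ≟ (x ∧ y)

  _<_ : Fin m → Fin m → Set
  _<_ = Strict _≡_ _≤_

  ∨-≰ : ∀ {a c d} → ¬ (c ∨ d) ≤ a → ¬ c ≤ a ⊎ ¬ d ≤ a
  ∨-≰ {a} {c} {d} c∨d≰a with c ≤? a | d ≤? a
  ... | no  c≰a | _       = inj₁ c≰a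
  ... | yes _   | no  d≰a = inj₂ d≰a
  ... | yes c≤a | yes d≤a = contradiction (∨-least c≤a d≤a) c∨d≰a

  JoinPrime : Fin m → Set
  JoinPrime p = ∀ x y → p ≤ x ∨ y → p ≤ x ⊎ p ≤ y

  joinPrime? : ∀ p → Dec (JoinPrime p)
  joinPrime? p = all? λ x → all? λ y → (p ≤? (x ∨ y)) →-dec ((p ≤? x) ⊎-dec (p ≤? y))

  does-≤-∧ : ∀ r x y → does (r ≤? (x ∧ y)) ≡ does (r ≤? x) Bool.∧ does (r ≤? y)
  does-≤-∧ r x y = does-⇔ r≤x∧y⇔ (r ≤? (x ∧ y)) ((r ≤? x) ×-dec (r ≤? y))
    where
      r≤x∧y⇔ : r ≤ x ∧ y ⇔ (r ≤ x × r ≤ y)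
      r≤x∧y⇔ = mk⇔ (λ r≤x∧y → ≤-trans r≤x∧y (x∧y≤x x y) , ≤-trans r≤x∧y (x∧y≤y x y))
                   (λ (r≤x , r≤y) → ∧-greatest r≤x r≤y)

  does-≤-∨ : ∀ {r} → JoinPrime r → ∀ x y → does (r ≤? (x ∨ y)) ≡ does (r ≤? x) Bool.∨ does (r ≤? y)
  does-≤-∨ {r} r-prime x y = does-⇔ r≤x∨y⇔ (r ≤? (x ∨ y)) ((r ≤? x) ⊎-dec (r ≤? y))
    where
      r≤x∨y⇔ : r ≤ x ∨ y ⇔ (r ≤ x ⊎ r ≤ y)
      r≤x∨y⇔ = mk⇔ (r-prime x y) λ { (inj₁ r≤x) → ≤-trans r≤x (x≤x∨y x y)
                                    ; (inj₂ r≤y) → ≤-trans r≤y (y≤x∨y x y) }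

  SplitBy : Fin m → Fin m → Fin m → Set
  SplitBy b x y = b ≤ x ∨ y × ¬ b ≤ x × ¬ b ≤ y

  splitBy? : ∀ b x y → Dec (SplitBy b x y)
  splitBy? b x y = (b ≤? (x ∨ y)) ×-dec (¬? (b ≤? x) ×-dec ¬? (b ≤? y))

  unsplit⇒joinPrime : ∀ {b} → ¬ (∃₂ (SplitBy b)) → JoinPrime b
  unsplit⇒joinPrime {b} unsplit x y b≤x∨y with b ≤? x | b ≤? y
  ... | yes b≤x | _       = inj₁ b≤x
  ... | no  _   | yes b≤y = inj₂ b≤y
  ... | no  b≰x | no  b≰y = contradiction (x , y , b≤x∨y , b≰x , b≰y) unsplit

  -- Distributivity: b = b ∧ (x ∨ y) = (b ∧ x) ∨ (b ∧ y).
  split⇒join-of-smaller : ∀ {b x y} → SplitBy b x y → ∃₂ λ c d → c < b × d < b × c ∨ d ≡ b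
  split⇒join-of-smaller {b} {x} {y} (b≤x∨y , b≰x , b≰y) =
    b ∧ x , b ∧ y , (x∧y≤x b x , b≰x ∘ sym) , (x∧y≤x b y , b≰y ∘ sym) ,
    trans (sym (∧-distribˡ-∨ b x y)) (sym b≤x∨y)

  joinPrime-below : (P : Fin m → Set) → (∀ {c d} → P (c ∨ d) → P c ⊎ P d) →
    ∀ {b} → P b → ∃ λ p → JoinPrime p × p ≤ b × P p
  joinPrime-below P split {b} = go (po-wellFounded isPartialOrder b)
    where
      go : ∀ {b} → Acc _<_ b → P b → ∃ λ p → JoinPrime p × p ≤ b × P p
      go {b} (acc smaller) Pb with any? (λ x → any? (splitBy? b x))
      ... | no unsplit = b , unsplit⇒joinPrime unsplit , ≤-refl , Pb
      ... | yes (_ , _ , s) with split⇒join-of-smaller s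
      ... | c , d , c<b , d<b , c∨d≡b with split (subst P (sym c∨d≡b) Pb)
      ... | inj₁ Pc = let p , p-prime , p≤c , Pp = go (smaller c<b) Pc
                      in p , p-prime , ≤-trans p≤c (proj₁ c<b) , Pp
      ... | inj₂ Pd = let p , p-prime , p≤d , Pp = go (smaller d<b) Pd
                      in p , p-prime , ≤-trans p≤d (proj₁ d<b) , Pp

module ImageInProductOfChains {m d : ℕ} {n : Fin (suc d) → ℕ} {_∨_ _∧_ : Op₂ (Fin m)}
  (φ : Fin m → Point (suc d) n)
  (φ-∧ : ∀ u v → φ (u ∧ v) ≈P (φ u ⊓P φ v))
  (φ-∨ : ∀ u v → φ (u ∨ v) ≈P (φ u ⊔P φ v)) where

  intervalsAt : (i j : Fin (suc d)) → List (VInterval (suc d) n)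
  intervalsAt i j = concatMap (λ α → map (vint i j α) (allFin _)) (allFin _)

  intervalsFrom : Fin (suc d) → List (VInterval (suc d) n)
  intervalsFrom i = concatMap (intervalsAt i) (allFin _)

  vertexIntervals : List (VInterval (suc d) n)
  vertexIntervals = concatMap intervalsFrom (allFin _)

  ∈-vertexIntervals : ∀ I → I ∈ vertexIntervals
  ∈-vertexIntervals (vint i j α β) =
    ∈-concatMap⁺ intervalsFrom (lose (∈-allFin i)
      (∈-concatMap⁺ (intervalsAt i) (lose (∈-allFin j)
        (∈-concatMap⁺ (λ α → map (vint i j α) (allFin _)) (lose (∈-allFin α)
          (∈-map⁺ (vint i j α) (∈-allFin β)))))))

  inVI? : ∀ I x → Dec (InVI {suc d} {n} I x)
  inVI? (vint i j α β) x = (toℕ α ℕ.≤? toℕ (x i)) ×-dec (toℕ (x j) ℕ.≤? toℕ β)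

  Hits : VInterval (suc d) n → Set
  Hits I = ∃ λ u → InVI I (φ u)

  hits? : ∀ I → Dec (Hits I)
  hits? I = any? λ u → inVI? I (φ u)

  missedIntervals : List (VInterval (suc d) n)
  missedIntervals = filter (¬? ∘ hits?) vertexIntervals

  image-outside-missed : ∀ u → ¬ InUnion missedIntervals (φ u)
  image-outside-missed u u∈ =
    let I , I∈ , φu∈I = find u∈
    in proj₂ (∈-filter⁻ (¬? ∘ hits?) {xs = vertexIntervals} I∈) (u , φu∈I)

  coord : Fin (suc d) → Fin m → ℕ
  coord i u = toℕ (φ u i)

  coord-∧ : ∀ i u v → coord i (u ∧ v) ≡ coord i u ⊓ coord i v
  coord-∧ i u v = trans (cong toℕ (φ-∧ u v i)) (toℕ-minF (φ u i) (φ v i))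

  coord-∨ : ∀ i u v → coord i (u ∨ v) ≡ coord i u ⊔ coord i v
  coord-∨ i u v = trans (cong toℕ (φ-∨ u v i)) (toℕ-maxF (φ u i) (φ v i))

  ⋀ ⋁ : ∀ {k} → (Fin (suc k) → Fin m) → Fin m
  ⋀ {0}     f = f 0F
  ⋀ {suc _} f = f 0F ∧ ⋀ (f ∘ suc)
  ⋁ {0}     f = f 0F
  ⋁ {suc _} f = f 0F ∨ ⋁ (f ∘ suc)

  coord-⋀-≤ : ∀ i {k} (f : Fin (suc k) → Fin m) j → coord i (⋀ f) ℕ.≤ coord i (f j)
  coord-⋀-≤ i {0}     f 0F      = ℕ.≤-refl
  coord-⋀-≤ i {suc _} f 0F      = ℕ.≤-trans (ℕ.≤-reflexive (coord-∧ i _ _)) (ℕ.m⊓n≤m _ _)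
  coord-⋀-≤ i {suc _} f (suc j) = ℕ.≤-trans (ℕ.≤-reflexive (coord-∧ i _ _))
                                    (ℕ.m≤n⇒o⊓m≤n _ (coord-⋀-≤ i (f ∘ suc) j))

  ≤-coord-⋀ : ∀ i {k} (f : Fin (suc k) → Fin m) {t} →
    (∀ j → t ℕ.≤ coord i (f j)) → t ℕ.≤ coord i (⋀ f)
  ≤-coord-⋀ i {0}     f t≤ = t≤ 0F
  ≤-coord-⋀ i {suc _} f t≤ = ℕ.≤-trans (ℕ.⊓-glb (t≤ 0F) (≤-coord-⋀ i (f ∘ suc) (t≤ ∘ suc)))
                                        (ℕ.≤-reflexive (sym (coord-∧ i _ _)))

  ≤-coord-⋁ : ∀ i {k} (f : Fin (suc k) → Fin m) j → coord i (f j) ℕ.≤ coord i (⋁ f)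
  ≤-coord-⋁ i {0}     f 0F      = ℕ.≤-refl
  ≤-coord-⋁ i {suc _} f 0F      = ℕ.≤-trans (ℕ.m≤m⊔n _ _) (ℕ.≤-reflexive (sym (coord-∨ i _ _)))
  ≤-coord-⋁ i {suc _} f (suc j) = ℕ.≤-trans (ℕ.m≤n⇒m≤o⊔n _ (≤-coord-⋁ i (f ∘ suc) j))
                                    (ℕ.≤-reflexive (sym (coord-∨ i _ _)))

  coord-⋁-≤ : ∀ i {k} (f : Fin (suc k) → Fin m) {t} →
    (∀ j → coord i (f j) ℕ.≤ t) → coord i (⋁ f) ℕ.≤ t
  coord-⋁-≤ i {0}     f ≤t = ≤t 0F
  coord-⋁-≤ i {suc _} f ≤t = ℕ.≤-trans (ℕ.≤-reflexive (coord-∨ i _ _))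
                                        (ℕ.⊔-lub (≤t 0F) (coord-⋁-≤ i (f ∘ suc) (≤t ∘ suc)))

  outside-missed⇒image : ∀ x → ¬ InUnion missedIntervals x → ∃ λ u → φ u ≈P x
  outside-missed⇒image x x∉ = ⋁ rows , λ k → toℕ-injective (ℕ.≤-antisym (upper k) (lower k))
    where
      hit : ∀ i j → Hits (vint i j (x i) (x j))
      hit i j with hits? (vint i j (x i) (x j))
      ... | yes h = h
      ... | no ¬h = contradiction
        (lose (∈-filter⁺ (¬? ∘ hits?) (∈-vertexIntervals _) ¬h) (ℕ.≤-refl , ℕ.≤-refl)) x∉

      rows : Fin (suc d) → Fin m
      rows i = ⋀ λ j → proj₁ (hit i j)

      upper : ∀ k → coord k (⋁ rows) ℕ.≤ toℕ (x k)
      upper k = coord-⋁-≤ k rows λ i →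
        ℕ.≤-trans (coord-⋀-≤ k _ k) (proj₂ (proj₂ (hit i k)))

      lower : ∀ k → toℕ (x k) ℕ.≤ coord k (⋁ rows)
      lower k = ℕ.≤-trans (≤-coord-⋀ k _ λ j → proj₁ (proj₂ (hit k j))) (≤-coord-⋁ k rows k)

module Embedding {m : ℕ} (G : ReflGraph m) {_∨_ _∧_ : Op₂ (Fin m)}
  (isDistributiveLattice : IsDistributiveLattice _≡_ _∨_ _∧_)
  (compatible : Compatible G _∨_ _∧_) where

  open FiniteDistributiveLattice isDistributiveLattice

  _~_ : Fin m → Fin m → Set
  u ~ v = u ∼⟨ G ⟩ v

  _~?_ : ∀ u v → Dec (u ~ v)
  u ~? v = ReflGraph.adj G u v Bool.≟ true

  ~-refl : ∀ u → u ~ u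
  ~-refl = ReflGraph.refl′ G

  ~-sym : ∀ {u v} → u ~ v → v ~ u
  ~-sym {u} {v} u~v = trans (ReflGraph.sym′ G v u) u~v

  ∧-~ : ∀ {u u′ v v′} → u ~ u′ → v ~ v′ → (u ∧ v) ~ (u′ ∧ v′)
  ∧-~ u~u′ v~v′ = proj₁ (compatible _ _ _ _ u~u′ v~v′)

  ∨-~ : ∀ {u u′ v v′} → u ~ u′ → v ~ v′ → (u ∨ v) ~ (u′ ∨ v′)
  ∨-~ u~u′ v~v′ = proj₂ (compatible _ _ _ _ u~u′ v~v′)

  ~-shrinkʳ : ∀ {a u b} → a ≤ u → u ≤ b → a ~ b → a ~ u
  ~-shrinkʳ {a} {u} {b} a≤u u≤b a~b =
    subst₂ _~_ (sym a≤u) (trans (∧-comm b u) (sym u≤b)) (∧-~ a~b (~-refl u))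

  ~-shrinkˡ : ∀ {a u b} → a ≤ u → u ≤ b → a ~ b → u ~ b
  ~-shrinkˡ {a} {u} {b} a≤u u≤b a~b =
    subst₂ _~_ (x≤y⇒x∨y≈y a≤u) (trans (∨-comm b u) (x≤y⇒x∨y≈y u≤b)) (∨-~ a~b (~-refl u))

  ∧~∨⇒~ : ∀ {u v} → (u ∧ v) ~ (u ∨ v) → u ~ v
  ∧~∨⇒~ {u} {v} ∧~∨ =
    subst₂ _~_ (∨-absorbs-∧ u v) (x≤y⇒x∨y≈y (x∧y≤y u v)) (∨-~ (~-sym ∧~u) ∧~v)
    where
      ∧~u : (u ∧ v) ~ u
      ∧~u = ~-shrinkʳ (x∧y≤x u v) (x≤x∨y u v) ∧~∨
      ∧~v : (u ∧ v) ~ v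
      ∧~v = ~-shrinkʳ (x∧y≤y u v) (y≤x∨y u v) ∧~∨

  -- The neighbours of x are closed under ∧ (compatibility with x ∧ x = x),
  -- so their meet is the least neighbour.
  lowestNeighbour : Fin m → Fin m
  lowestNeighbour x = foldr _∧_ x (filter (_~? x) (allFin m))

  lowestNeighbour-~ : ∀ x → lowestNeighbour x ~ x
  lowestNeighbour-~ x = meet-~ (all-filter (_~? x) (allFin m))
    where
      meet-~ : ∀ {ys} → All (_~ x) ys → foldr _∧_ x ys ~ x
      meet-~ []                    = ~-refl x
      meet-~ {y ∷ ys} (y~x ∷ ys~x) =
        subst ((y ∧ foldr _∧_ x ys) ~_) (∧-idem x) (∧-~ y~x (meet-~ ys~x))

  lowestNeighbour-≤ : ∀ {x y} → y ~ x → lowestNeighbour x ≤ y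
  lowestNeighbour-≤ {x} y~x = meet-≤ (∈-filter⁺ (_~? x) (∈-allFin _) y~x)
    where
      meet-≤ : ∀ {y ys} → y ∈ ys → foldr _∧_ x ys ≤ y
      meet-≤ (here refl) = x∧y≤x _ _
      meet-≤ (there y∈)  = ≤-trans (x∧y≤y _ _) (meet-≤ y∈)

  lowestNeighbour-∨ : ∀ c d → lowestNeighbour (c ∨ d) ≤ lowestNeighbour c ∨ lowestNeighbour d
  lowestNeighbour-∨ c d = lowestNeighbour-≤ (∨-~ (lowestNeighbour-~ c) (lowestNeighbour-~ d))

  lowestNeighbour-≤-neighbour : ∀ {p u v} → p ≤ u → u ~ v → lowestNeighbour p ≤ v
  lowestNeighbour-≤-neighbour {p} {u} {v} p≤u u~v =
    ≤-trans (lowestNeighbour-≤ p∧v~p) (x∧y≤y p v)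
    where
      p∧v~p : (p ∧ v) ~ p
      p∧v~p = subst ((p ∧ v) ~_) (sym p≤u) (∧-~ (~-refl p) (~-sym u~v))

  Admissible : Fin m → Fin m → Set
  Admissible p q = JoinPrime p × JoinPrime q × q ≤ lowestNeighbour p

  admissible? : ∀ p q → Dec (Admissible p q)
  admissible? p q = joinPrime? p ×-dec joinPrime? q ×-dec (q ≤? lowestNeighbour p)

  admissible-⇒ : ∀ {p q x y} → Admissible p q → x ~ y → p ≤ x → q ≤ y
  admissible-⇒ (_ , _ , q≤) x~y p≤x = ≤-trans q≤ (lowestNeighbour-≤-neighbour p≤x x~y)

  admissiblePartner : ∀ {p} → JoinPrime p → ∃ λ q → Admissible p q
  admissiblePartner {p} p-prime =
    let q , q-prime , q≤ , _ = joinPrime-below (λ _ → ⊤) (λ _ → inj₁ tt) {lowestNeighbour p} tt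
    in q , p-prime , q-prime , q≤

  level-at : Fin m → Fin m → Fin m → Fin 3
  level-at p q x = level (does (q ≤? x)) (does (p ≤? x))

  module _ {p q : Fin m} (pq : Admissible p q) where

    level-at-∧ : ∀ x y → level-at p q (x ∧ y) ≡ minF (level-at p q x) (level-at p q y)
    level-at-∧ x y =
      trans (cong₂ level (does-≤-∧ q x y) (does-≤-∧ p x y)) (level-∧ (nested x) (nested y))
      where
        nested : ∀ z → does (p ≤? z) ≤ᵇ does (q ≤? z)
        nested z = does-mono (admissible-⇒ pq (~-refl z)) (p ≤? z) (q ≤? z)

    level-at-∨ : ∀ x y → level-at p q (x ∨ y) ≡ maxF (level-at p q x) (level-at p q y)
    level-at-∨ x y = let p-prime , q-prime , _ = pq in
      trans (cong₂ level (does-≤-∨ q-prime x y) (does-≤-∨ p-prime x y))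
        (level-∨ (does (q ≤? x)) (does (p ≤? x)) (does (q ≤? y)) (does (p ≤? y)))

    level-at-~ : ∀ {x y} → x ~ y → level-at p q x ∼⟨ path₃ ⟩ level-at p q y
    level-at-~ {x} {y} x~y =
      level-adjacent (does-mono (admissible-⇒ pq x~y) (p ≤? x) (q ≤? y))
                     (does-mono (admissible-⇒ pq (~-sym x~y)) (p ≤? y) (q ≤? x))

    level-at-0 : ∀ {x} → ¬ q ≤ x → level-at p q x ≡ 0F
    level-at-0 {x} q≰x =
      cong₂ level (dec-false (q ≤? x) q≰x) (dec-false (p ≤? x) (q≰x ∘ admissible-⇒ pq (~-refl x)))

  level-at-2 : ∀ {p q x} → p ≤ x → level-at p q x ≡ 2F
  level-at-2 {p} {q} {x} p≤x = cong (level (does (q ≤? x))) (dec-true (p ≤? x) p≤x)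

  level-at-≢2 : ∀ {p q x} → ¬ p ≤ x → level-at p q x ≢ 2F
  level-at-≢2 {p} {q} {x} p≰x rewrite dec-false (p ≤? x) p≰x = level-false≢2 (does (q ≤? x))

  coordinate : ∀ {p q} → Dec (Admissible p q) → Fin m → Fin 3
  coordinate {p} {q} (yes _) = level-at p q
  coordinate         (no _)  = λ _ → 0F

  coordinate-∧ : ∀ {p q} (pq? : Dec (Admissible p q)) u v →
    coordinate pq? (u ∧ v) ≡ minF (coordinate pq? u) (coordinate pq? v)
  coordinate-∧ (yes pq) = level-at-∧ pq
  coordinate-∧ (no _)   = λ _ _ → refl

  coordinate-∨ : ∀ {p q} (pq? : Dec (Admissible p q)) u v →
    coordinate pq? (u ∨ v) ≡ maxF (coordinate pq? u) (coordinate pq? v)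
  coordinate-∨ (yes pq) = level-at-∨ pq
  coordinate-∨ (no _)   = λ _ _ → refl

  coordinate-~ : ∀ {p q} (pq? : Dec (Admissible p q)) {u v} → u ~ v →
    coordinate pq? u ∼⟨ path₃ ⟩ coordinate pq? v
  coordinate-~ (yes pq) = level-at-~ pq
  coordinate-~ (no _)   = λ _ → refl

  pairCoordinate : Fin m × Fin m → Fin m → Fin 3
  pairCoordinate (p , q) = coordinate (admissible? p q)

  d : ℕ
  d = suc (m * m)

  -- Coordinate 0F is a dummy making d ≥ 1 even when m = 0.
  φ : Fin m → Point d (λ _ → 2)
  φ u 0F      = 0F
  φ u (suc k) = pairCoordinate (remQuot m k) u

  φ-at : ∀ {p q} → Admissible p q → ∀ u → φ u (suc (combine p q)) ≡ level-at p q u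
  φ-at {p} {q} pq u =
    trans (cong (λ pair → pairCoordinate pair u) (remQuot-combine p q)) admissible-coordinate
    where
      admissible-coordinate : coordinate (admissible? p q) u ≡ level-at p q u
      admissible-coordinate with admissible? p q
      ... | yes _  = refl
      ... | no ¬pq = contradiction pq ¬pq

  φ-∧ : ∀ u v → φ (u ∧ v) ≈P (φ u ⊓P φ v)
  φ-∧ u v 0F      = refl
  φ-∧ u v (suc k) = coordinate-∧ (admissible? _ _) u v

  φ-∨ : ∀ u v → φ (u ∨ v) ≈P (φ u ⊔P φ v)
  φ-∨ u v 0F      = refl
  φ-∨ u v (suc k) = coordinate-∨ (admissible? _ _) u v

  φ-~ : ∀ {u v} → u ~ v → ∀ i → φ u i ∼⟨ path₃ ⟩ φ v i
  φ-~ u~v 0F      = refl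
  φ-~ u~v (suc k) = coordinate-~ (admissible? _ _) u~v

  φ-reflects-≤ : ∀ {u v} → φ u ≈P φ v → u ≤ v
  φ-reflects-≤ {u} {v} φu≈φv = decidable-stable (u ≤? v) λ u≰v →
    let p , p-prime , p≤u , p≰v = joinPrime-below (λ z → ¬ z ≤ v) ∨-≰ u≰v
        q , pq = admissiblePartner p-prime
    in level-at-≢2 {q = q} p≰v (begin
      level-at p q v           ≡⟨ φ-at pq v ⟨
      φ v (suc (combine p q))  ≡⟨ φu≈φv _ ⟨
      φ u (suc (combine p q))  ≡⟨ φ-at pq u ⟩
      level-at p q u           ≡⟨ level-at-2 {q = q} p≤u ⟩
      2F                       ∎)
    where open ≡-Reasoning

  φ-injective : ∀ u v → φ u ≈P φ v → u ≡ v
  φ-injective u v φu≈φv = ≤-antisym (φ-reflects-≤ φu≈φv) (φ-reflects-≤ (sym ∘ φu≈φv))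

  Separates : Fin m → Fin m → Fin m → Fin m → Set
  Separates p q u v = p ≤ u × ¬ q ≤ v

  -- With a = u ∧ v and b = u ∨ v: a ≁ b forces lowestNeighbour b ≰ a; descend to a
  -- join-prime p ≤ b with lowestNeighbour p ≰ a, then to a join-prime q ≤ lowestNeighbour p
  -- with q ≰ a. As p lies below u or v, and q cannot lie below both, (p , q) separates them.
  separatingPair : ∀ {u v} → ¬ u ~ v →
    ∃₂ λ p q → Admissible p q × (Separates p q u v ⊎ Separates p q v u)
  separatingPair {u} {v} u≁v =
    let p , p-prime , p≤b , lowp≰a =
          joinPrime-below (λ z → ¬ lowestNeighbour z ≤ a) lowestNeighbour-≰ lowb≰a
        q , q-prime , q≤lowp , q≰a = joinPrime-below (λ z → ¬ z ≤ a) ∨-≰ lowp≰a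
        q≤p = ≤-trans q≤lowp (lowestNeighbour-≤ (~-refl p))
    in p , q , (p-prime , q-prime , q≤lowp) ,
       Sum.map (λ p≤u → p≤u , λ q≤v → q≰a (∧-greatest (≤-trans q≤p p≤u) q≤v))
               (λ p≤v → p≤v , λ q≤u → q≰a (∧-greatest q≤u (≤-trans q≤p p≤v)))
               (p-prime u v p≤b)
    where
      a b : Fin m
      a = u ∧ v
      b = u ∨ v

      lowb≰a : ¬ lowestNeighbour b ≤ a
      lowb≰a lowb≤a =
        u≁v (∧~∨⇒~ (~-shrinkˡ lowb≤a (≤-trans (x∧y≤x u v) (x≤x∨y u v)) (lowestNeighbour-~ b)))

      lowestNeighbour-≰ : ∀ {c d} → ¬ lowestNeighbour (c ∨ d) ≤ a →
        ¬ lowestNeighbour c ≤ a ⊎ ¬ lowestNeighbour d ≤ a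
      lowestNeighbour-≰ {c} {d} low≰a = ∨-≰ (low≰a ∘ ≤-trans (lowestNeighbour-∨ c d))

  φ-apart : ∀ {p q u v} → Admissible p q → Separates p q u v →
    ¬ (φ u (suc (combine p q)) ∼⟨ path₃ ⟩ φ v (suc (combine p q)))
  φ-apart {q = q} {u} {v} pq (p≤u , q≰v) =
    subst₂ (λ x y → ¬ (x ∼⟨ path₃ ⟩ y))
      (sym (trans (φ-at pq u) (level-at-2 {q = q} p≤u)))
      (sym (trans (φ-at pq v) (level-at-0 pq q≰v)))
      λ ()

  φ-reflects-~ : ∀ {u v} → (∀ i → φ u i ∼⟨ path₃ ⟩ φ v i) → u ~ v
  φ-reflects-~ {u} {v} φu~φv = decidable-stable (u ~? v) (apart ∘ separatingPair)
    where
      apart : ¬ ∃₂ λ p q → Admissible p q × (Separates p q u v ⊎ Separates p q v u)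
      apart (_ , _ , pq , inj₁ separates) = φ-apart pq separates (φu~φv _)
      apart (_ , _ , pq , inj₂ separates) =
        φ-apart pq separates (trans (ReflGraph.sym′ path₃ _ _) (φu~φv _))

theorem5p1 : (m : ℕ) (G : ReflGraph m) (_∨_ _∧_ : Op₂ (Fin m)) →
  IsDistributiveLattice _≡_ _∨_ _∧_ → Compatible G _∨_ _∧_ →
  Σ ℕ λ d → d ≥ 1 × Σ (Fin d → ℕ) λ n → Σ (List (VInterval d n)) λ 𝒱 →
  Σ (Fin m → Point d n) λ φ → Σ ((i : Fin d) → ReflGraph (suc (n i))) λ Gs →
    (∀ u v → φ u ≈P φ v → u ≡ v) ×
    (∀ u → ¬ InUnion 𝒱 (φ u)) ×
    (∀ x → ¬ InUnion 𝒱 x → ∃ λ u → φ u ≈P x) ×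
    (∀ u v → φ (u ∧ v) ≈P (φ u ⊓P φ v)) ×
    (∀ u v → φ (u ∨ v) ≈P (φ u ⊔P φ v)) ×
    (∀ i → ProperInterval (Gs i) × Compatible (Gs i) maxF minF) ×
    (∀ u v → (u ∼⟨ G ⟩ v) ⇔ (∀ i → φ u i ∼⟨ Gs i ⟩ φ v i))
theorem5p1 m G _∨_ _∧_ isDistributiveLattice compatible =
  d , s≤s z≤n , (λ _ → 2) , missedIntervals , φ , (λ _ → path₃) ,
  φ-injective , image-outside-missed , outside-missed⇒image , φ-∧ , φ-∨ ,
  (λ _ → path₃-properInterval , path₃-compatible) ,
  λ u v → mk⇔ (λ u~v → φ-~ u~v) φ-reflects-~
  where
    open Embedding G isDistributiveLattice compatible
    open ImageInProductOfChains φ φ-∧ φ-∨
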